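{- Let $n\ge2$ and suppose the word $\underline{b}$ immediately follows $\underline{a}=a_1\cdots a_n$ in $G_n$, differing from it exactly in position $k$, where $k<n$. If $a_j=1$ for all $j>k$, then $a_1+\cdots+a_k+(k-1)\equiv0\pmod2$; and if $a_j=2j-1$ for all $j>k$, then $a_1+\cdots+a_k+(k-1)\equiv1\pmod2$.
   Context: The list $G_n$ of words $a_1\cdots a_n$ (with $1\le a_i\le 2i-1$) is defined recursively: $G_1=(1)$; for $n\ge2$, if $G_{n-1}=(w_1,\ldots,w_N)$, then $G_n$ is the concatenation over $m=1,\ldots,N$ of the blocks $(w_m1,w_m2,\ldots,w_m(2n-1))$ for $m$ odd and $(w_m(2n-1),\ldots,w_m1)$ for $m$ even, where $w_mx$ denotes $w_m$ with the letter $x$ appended. Consecutive words of $G_n$ differ in exactly one position. -}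

module Defs where

open import Data.Bool using (Bool; true; false; not)
open import Data.Nat using (ℕ; zero; suc; _+_; _*_; _∸_)
open import Data.List using (List; []; _∷_; _++_; map; reverse; upTo; [_])

-- Words a₁⋯aₙ are represented as lists [a₁, …, aₙ] (a₁ first).

letters : ℕ → List ℕ
letters r = map suc (upTo r)

snoc : List ℕ → ℕ → List ℕ
snoc w x = w ++ [ x ]

-- block of w: (w1, …, wr) if the index of w is odd, (wr, …, w1) if even
block : ℕ → Bool → List ℕ → List (List ℕ)
block r true  w = map (snoc w) (letters r)
block r false w = map (snoc w) (reverse (letters r))

-- concatenation of blocks over w_m, w_{m+1}, …; the Bool says whether m is odd
expand : ℕ → Bool → List (List ℕ) → List (List ℕ)
expand r odd []       = []
expand r odd (w ∷ ws) = block r odd w ++ expand r (not odd) ws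

-- The list G_n.  G 0 is not used by the paper (set to the empty list).
G : ℕ → List (List ℕ)
G zero = []
G (suc zero) = [ [ 1 ] ]
G (suc (suc m)) = expand (2 * (suc (suc m)) ∸ 1) true (G (suc m))

-- 1-indexed letter access: at w j = a_j for 1 ≤ j ≤ length w (0 otherwise)
at : List ℕ → ℕ → ℕ
at []       _             = 0
at (x ∷ xs) zero          = 0
at (x ∷ xs) (suc zero)    = x
at (x ∷ xs) (suc (suc j)) = at xs (suc j)

open import Data.Product using (∃₂; ∃-syntax)
open import Relation.Binary.PropositionalEquality using (_≡_)

Follows : List (List ℕ) → List ℕ → List ℕ → Set
Follows xs a b = ∃₂ λ p s → xs ≡ p ++ (a ∷ b ∷ s)

module Submission where

-- Write the parity of a word w as  par w = [sum w + length w is even].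
-- (1) Parity alternates along G_n, starting with an even word: appending the
--     letters 1,2,…,r (r odd) to w alternates parity starting and ending at
--     par w, so the blocks of G_n alternate exactly as the words of G_{n-1}
--     do; hence the m-th word of G_{n-1} is even iff m is odd, i.e. iff its
--     block in G_n is increasing.
-- (2) Consequently two consecutive words of G_n = expand (2n-1) (G_{n-1})
--     either lie in one block (they differ only in the last letter), or are
--     w ℓ, w' y with w, w' consecutive in G_{n-1} and ℓ the last letter of
--     the block of w, namely 2n-1 if par w is even and 1 otherwise.
-- (3) Induction on n then gives the key lemma: if consecutive words a, b of
--     G_n differ in position k < n, then a_{k+1} = 2k+1 if a_1…a_k has even
--     parity and a_{k+1} = 1 otherwise.
-- Corollary 5.6 reads (3) backwards: for k ≥ 1, 2k+1 ≠ 1, so a_{k+1} = 1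
-- forces a_1+⋯+a_k+k odd and a_{k+1} = 2k+1 forces it even.

open import Defs
open import Data.Nat using (ℕ; zero; suc; _+_; _*_; _∸_; _≤_; _<_; _%_; s≤s)
open import Data.Nat.Properties
  using (+-suc; +-comm; +-identityʳ; suc-injective; m≤n⇒m<n∨m≡n; m+n≡0⇒n≡0; m≤n⇒m⊓n≡m; ≤-refl; <⇒≤)
open import Data.Nat.Tactic.RingSolver using (solve-∀)
open import Data.Bool using (Bool; true; false; not; _xor_; if_then_else_)
open import Data.Bool.Properties using (not-involutive; not-distribˡ-xor; xor-inverseˡ)
open import Data.List using (List; []; _∷_; _++_; map; reverse; upTo; applyUpTo; [_]; take; length; _∷ʳ_)
open import Data.List.Properties
  using (map-++; upTo-∷ʳ; reverse-++; unfold-reverse; ∷ʳ-injectiveʳ; ∷-injectiveˡ; length-++; length-take; take-all)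
open import Data.List.Relation.Unary.All using (All; []; _∷_; universal)
open import Data.List.Relation.Unary.All.Properties using (map⁺; ++⁺)
open import Data.Nat.ListAction using (sum)
open import Data.Nat.ListAction.Properties using (sum-++)
open import Data.Product using (_×_; _,_; ∃; ∃₂; proj₁; proj₂)
open import Data.Sum using (_⊎_; inj₁; inj₂)
open import Data.Empty using (⊥-elim)
open import Relation.Binary.PropositionalEquality
  using (_≡_; _≢_; refl; sym; trans; cong; cong₂; subst; subst₂; module ≡-Reasoning)

open ≡-Reasoning

data Consecutive {A : Set} : List A → A → A → Set where
  here  : ∀ {a b s} → Consecutive (a ∷ b ∷ s) a b
  there : ∀ {x xs a b} → Consecutive xs a b → Consecutive (x ∷ xs) a b

follows⇒consecutive : ∀ {A : Set} (p : List A) {a b s xs} → xs ≡ p ++ (a ∷ b ∷ s) → Consecutive xs a b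
follows⇒consecutive []      refl = here
follows⇒consecutive (x ∷ p) refl = there (follows⇒consecutive p refl)

consecutive-++ : ∀ {A : Set} (xs ys : List A) {a b} → Consecutive (xs ++ ys) a b →
  Consecutive xs a b ⊎ Consecutive ys a b ⊎ ((∃ λ t → xs ≡ t ∷ʳ a) × (∃ λ s → ys ≡ b ∷ s))
consecutive-++ []               ys       c = inj₂ (inj₁ c)
consecutive-++ (x ∷ [])         (y ∷ ys) here = inj₂ (inj₂ (([] , refl) , (ys , refl)))
consecutive-++ (x ∷ x' ∷ xs)    ys       here = inj₁ here
consecutive-++ (x ∷ xs)         ys       (there c) with consecutive-++ xs ys c
... | inj₁ c' = inj₁ (there c')
... | inj₂ (inj₁ c') = inj₂ (inj₁ c')
... | inj₂ (inj₂ ((t , e) , tail)) = inj₂ (inj₂ ((x ∷ t , cong (x ∷_) e) , tail))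

consecutive-map : ∀ {A B : Set} (f : A → B) xs {a b} → Consecutive (map f xs) a b →
  ∃₂ λ x y → a ≡ f x × b ≡ f y
consecutive-map f (x ∷ y ∷ xs) here      = x , y , refl , refl
consecutive-map f (x ∷ xs)     (there c) = consecutive-map f xs c

consecutive-All : ∀ {A : Set} {P : A → Set} {xs a b} → Consecutive xs a b → All P xs → P a × P b
consecutive-All here      (pa ∷ pb ∷ _) = pa , pb
consecutive-All (there c) (_ ∷ ps)      = consecutive-All c ps

isEven : ℕ → Bool
isEven zero    = true
isEven (suc n) = not (isEven n)

isEven-+ : ∀ m n → isEven (m + n) ≡ not (isEven m) xor isEven n
isEven-+ zero    n = refl
isEven-+ (suc m) n = trans (cong not (isEven-+ m n)) (not-distribˡ-xor (not (isEven m)) (isEven n))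

isEven-odd : ∀ k → isEven (2 * suc k ∸ 1) ≡ false
isEven-odd k = begin
  isEven (k + suc (k + 0))   ≡⟨ cong (λ m → isEven (k + suc m)) (+-identityʳ k) ⟩
  isEven (k + suc k)         ≡⟨ cong isEven (+-suc k k) ⟩
  not (isEven (k + k))       ≡⟨ cong not (isEven-+ k k) ⟩
  not (not (isEven k) xor isEven k)  ≡⟨ cong not (xor-inverseˡ (isEven k)) ⟩
  false ∎

%2-by-successor : ∀ n → n % 2 ≡ (if isEven (suc n) then 1 else 0)
%2-by-successor zero          = refl
%2-by-successor (suc zero)    = refl
%2-by-successor (suc (suc n)) =
  trans (%2-by-successor n) (cong (if_then 1 else 0) (sym (not-involutive (isEven (suc n)))))

par : List ℕ → Bool
par w = isEven (sum w + length w)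

-- Appending x keeps the parity of w exactly when x is even (sum and length
-- together grow by x+1).
par-snoc : ∀ w x → par (snoc w x) ≡ isEven x xor par w
par-snoc w x = begin
  isEven (sum (w ++ [ x ]) + length (w ++ [ x ]))
    ≡⟨ cong₂ (λ s l → isEven (s + l)) (sum-++ w [ x ]) (length-++ w) ⟩
  isEven ((sum w + (x + 0)) + (length w + 1))
    ≡⟨ cong isEven (rearrange (sum w) x (length w)) ⟩
  isEven (suc x + (sum w + length w))
    ≡⟨ isEven-+ (suc x) _ ⟩
  not (not (isEven x)) xor par w
    ≡⟨ cong (_xor par w) (not-involutive (isEven x)) ⟩
  isEven x xor par w ∎
  where
  rearrange : ∀ s x l → (s + (x + 0)) + (l + 1) ≡ suc x + (s + l)
  rearrange = solve-∀

-- Alternating f o xs e: the values of f along xs are o, not o, o, …, and e is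
-- the value the next element would need (so e = o iff xs has even length).
data Alternating {A : Set} (f : A → Bool) : Bool → List A → Bool → Set where
  []  : ∀ {o} → Alternating f o [] o
  _∷_ : ∀ {o x xs e} → f x ≡ o → Alternating f (not o) xs e → Alternating f o (x ∷ xs) e

alternating-++ : ∀ {A : Set} {f : A → Bool} {o e e' xs ys} →
  Alternating f o xs e → Alternating f e ys e' → Alternating f o (xs ++ ys) e'
alternating-++ []       q = q
alternating-++ (p ∷ ps) q = p ∷ alternating-++ ps q

alternating-∷ʳ : ∀ {A : Set} {f : A → Bool} {o e xs x} →
  Alternating f o xs e → f x ≡ e → Alternating f o (xs ∷ʳ x) (not e)
alternating-∷ʳ ps p = alternating-++ ps (p ∷ [])

alternating-reverse : ∀ {A : Set} {f : A → Bool} {o e xs} →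
  Alternating f o xs e → Alternating f (not e) (reverse xs) (not o)
alternating-reverse []                 = []
alternating-reverse {f = f} {o} {e} {x ∷ xs} (p ∷ ps) =
  subst (Alternating f (not e) (reverse (x ∷ xs))) (not-involutive (not o))
    (subst (λ l → Alternating f (not e) l (not (not (not o)))) (sym (unfold-reverse x xs))
      (alternating-∷ʳ (alternating-reverse ps) (trans p (sym (not-involutive o)))))

alternating-map : ∀ {A B : Set} {f : A → Bool} {g : B → Bool} (h : A → B) (k : Bool → Bool) →
  (∀ c → k (not c) ≡ not (k c)) → (∀ x → g (h x) ≡ k (f x)) →
  ∀ {o e xs} → Alternating f o xs e → Alternating g (k o) (map h xs) (k e)
alternating-map h k k-not gh []       = []
alternating-map {g = g} h k k-not gh {o} (p ∷ ps) =
  trans (gh _) (cong k p) ∷ subst (λ c → Alternating g c _ _) (k-not o) (alternating-map h k k-not gh ps)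

letters-∷ʳ : ∀ r → letters (suc r) ≡ letters r ∷ʳ suc r
letters-∷ʳ r = trans (cong (map suc) (sym (upTo-∷ʳ r))) (map-++ suc (upTo r) [ r ])

alternating-letters : ∀ r → Alternating isEven false (letters r) (isEven (suc r))
alternating-letters zero    = []
alternating-letters (suc r) =
  subst (λ l → Alternating isEven false l (isEven (suc (suc r)))) (sym (letters-∷ʳ r))
    (alternating-∷ʳ (alternating-letters r) refl)

blockLetters : ℕ → Bool → List ℕ
blockLetters r true  = letters r
blockLetters r false = reverse (letters r)

block-map : ∀ r o w → block r o w ≡ map (snoc w) (blockLetters r o)
block-map r true  w = refl
block-map r false w = refl

alternating-appended : ∀ w {o e xs} → Alternating isEven o xs e →
  Alternating par (o xor par w) (map (snoc w) xs) (e xor par w)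
alternating-appended w = alternating-map (snoc w) (_xor par w) (λ c → sym (not-distribˡ-xor c (par w))) (par-snoc w)

alternating-block : ∀ r o w → isEven r ≡ false → Alternating par (par w) (block r o w) (not (par w))
alternating-block r true w r-odd =
  subst (λ c → Alternating par (par w) (block r true w) (not c xor par w)) r-odd
    (alternating-appended w (alternating-letters r))
alternating-block r false w r-odd =
  subst (λ c → Alternating par (not (not c) xor par w) (block r false w) (not (par w))) r-odd
    (alternating-appended w (alternating-reverse (alternating-letters r)))

alternating-expand : ∀ r {o e ws} → isEven r ≡ false →
  Alternating par o ws e → Alternating par o (expand r o ws) e
alternating-expand r r-odd []                              = []
alternating-expand r {o} {ws = w ∷ ws} r-odd (p ∷ ps) =
  alternating-++ (subst (λ c → Alternating par c (block r o w) (not c)) p (alternating-block r o w r-odd))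
                 (alternating-expand r r-odd ps)

alternating-G : ∀ n → ∃ λ e → Alternating par true (G n) e
alternating-G zero          = true , []
alternating-G (suc zero)    = false , (refl ∷ [])
alternating-G (suc (suc m)) =
  let e , alt = alternating-G (suc m) in
  e , alternating-expand _ (isEven-odd (suc m)) alt

length-snoc : ∀ w x → length (snoc w x) ≡ suc (length w)
length-snoc w x = trans (length-++ w) (+-comm (length w) 1)

length-expand : ∀ r o n ws → All (λ w → length w ≡ n) ws → All (λ w → length w ≡ suc n) (expand r o ws)
length-expand r o n []       []       = []
length-expand r o n (w ∷ ws) (p ∷ ps) =
  ++⁺ (subst (All _) (sym (block-map r o w))
         (map⁺ (universal (λ x → trans (length-snoc w x) (cong suc p)) (blockLetters r o))))
      (length-expand r (not o) n ws ps)

length-G : ∀ n → All (λ w → length w ≡ n) (G n)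
length-G zero          = []
length-G (suc zero)    = refl ∷ []
length-G (suc (suc m)) = length-expand _ true (suc m) (G (suc m)) (length-G (suc m))

lastLetter : ℕ → Bool → ℕ
lastLetter r true  = r
lastLetter r false = 1

block-last : ∀ r o w → ∃ λ t → block (suc r) o w ≡ t ∷ʳ snoc w (lastLetter (suc r) o)
block-last r true  w = _ , trans (cong (map (snoc w)) (letters-∷ʳ r)) (map-++ (snoc w) (letters r) [ suc r ])
block-last r false w = _ , trans (cong (map (snoc w)) (unfold-reverse 1 later)) (map-++ (snoc w) (reverse later) [ 1 ])
  where
  later : List ℕ
  later = map suc (applyUpTo suc r)

block-head : ∀ r o w → ∃₂ λ y s → block (suc r) o w ≡ snoc w y ∷ s
block-head r true  w = 1 , _ , refl
block-head r false w = suc r , _ , cong (map (snoc w)) (trans (cong reverse (letters-∷ʳ r)) (reverse-++ (letters r) [ suc r ]))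

data ExpandStep (ws : List (List ℕ)) (r : ℕ) : List ℕ → List ℕ → Set where
  inside : ∀ w x y → ExpandStep ws r (snoc w x) (snoc w y)
  across : ∀ {w w'} y → Consecutive ws w w' → ExpandStep ws r (snoc w (lastLetter r (par w))) (snoc w' y)

step-there : ∀ {w ws r a b} → ExpandStep ws r a b → ExpandStep (w ∷ ws) r a b
step-there (inside w x y) = inside w x y
step-there (across y c)   = across y (there c)

within-block : ∀ {ws r} w L {a b} → Consecutive (map (snoc w) L) a b → ExpandStep ws r a b
within-block w L c with consecutive-map (snoc w) L c
... | x , y , refl , refl = inside w x y

at-seam : ∀ r {o w ws a b} → par w ≡ o →
  (∃ λ t → block (suc r) o w ≡ t ∷ʳ a) → (∃ λ s → expand (suc r) (not o) ws ≡ b ∷ s) →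
  ExpandStep (w ∷ ws) (suc r) a b
at-seam r {ws = []} _ _ (_ , ())
at-seam r {o} {w} {w' ∷ ws} {a} {b} par-w (t , a-last) (s , b-first)
  with block-last r o w | block-head r (not o) w'
... | t' , last-eq | y , s' , head-eq =
  subst₂ (ExpandStep (w ∷ w' ∷ ws) (suc r)) (sym a≡) (sym b≡) (across y here)
  where
  a≡ : a ≡ snoc w (lastLetter (suc r) (par w))
  a≡ = trans (∷ʳ-injectiveʳ t t' (trans (sym a-last) last-eq)) (cong (λ c → snoc w (lastLetter (suc r) c)) (sym par-w))
  b≡ : b ≡ snoc w' y
  b≡ = ∷-injectiveˡ (trans (sym b-first) (cong (_++ expand (suc r) (not (not o)) ws) head-eq))

expand-step : ∀ r {o e ws a b} → Alternating par o ws e →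
  Consecutive (expand (suc r) o ws) a b → ExpandStep ws (suc r) a b
expand-step r {o} {ws = w ∷ ws} (p ∷ ps) c with consecutive-++ (block (suc r) o w) (expand (suc r) (not o) ws) c
... | inj₁ c'                         = within-block w _ (subst (λ l → Consecutive l _ _) (block-map (suc r) o w) c')
... | inj₂ (inj₁ c')                  = step-there (expand-step r ps c')
... | inj₂ (inj₂ (a-last , b-first)) = at-seam r p a-last b-first

at-snoc : ∀ w x k → k ≤ length w → at (snoc w x) k ≡ at w k
at-snoc []          x zero          _         = refl
at-snoc (y ∷ w)     x zero          _         = refl
at-snoc (y ∷ w)     x (suc zero)    _         = refl
at-snoc (y ∷ z ∷ w) x (suc (suc k)) (s≤s k≤) = at-snoc (z ∷ w) x (suc k) k≤

at-snoc-last : ∀ w x → at (snoc w x) (suc (length w)) ≡ x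
at-snoc-last []      x = refl
at-snoc-last (y ∷ w) x = at-snoc-last w x

take-snoc : ∀ w x k → k ≤ length w → take k (snoc w x) ≡ take k w
take-snoc w       x zero    _        = refl
take-snoc (y ∷ w) x (suc k) (s≤s k≤) = cong (y ∷_) (take-snoc w x k k≤)

LetterRule : ℕ → Set
LetterRule n = ∀ k {a b} → Consecutive (G n) a b → k < n → at a k ≢ at b k →
  at a (suc k) ≡ lastLetter (2 * suc k ∸ 1) (par (take k a))

-- The inductive step: a change at position k < n-1 is inherited from the
-- prefixes in G_{n-1}; a change at position n-1 happens across a seam.
letterRule-step : ∀ m → LetterRule (suc m) → LetterRule (suc (suc m))
letterRule-step m rule k c (s≤s k≤) differ =
  let la , lb = consecutive-All c (length-G (suc (suc m))) in
  from-step (expand-step _ (proj₂ (alternating-G (suc m))) c) la lb differ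
  where
  prefix-length : ∀ w x → length (snoc w x) ≡ suc (suc m) → length w ≡ suc m
  prefix-length w x l = suc-injective (trans (sym (length-snoc w x)) l)

  from-step : ∀ {a b} → ExpandStep (G (suc m)) (2 * suc (suc m) ∸ 1) a b →
    length a ≡ suc (suc m) → length b ≡ suc (suc m) → at a k ≢ at b k →
    at a (suc k) ≡ lastLetter (2 * suc k ∸ 1) (par (take k a))
  from-step (inside w x y) la _ differ =
    ⊥-elim (differ (trans (at-snoc w x k k≤w) (sym (at-snoc w y k k≤w))))
    where
    k≤w : k ≤ length w
    k≤w = subst (k ≤_) (sym (prefix-length w x la)) k≤
  from-step (across {w} {w'} y c') la lb differ with m≤n⇒m<n∨m≡n k≤
  ... | inj₂ refl = begin
    at (snoc w ℓ) (suc k)                          ≡⟨ cong (λ i → at (snoc w ℓ) (suc i)) (sym lw) ⟩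
    at (snoc w ℓ) (suc (length w))                 ≡⟨ at-snoc-last w ℓ ⟩
    ℓ                                              ≡⟨ cong (λ v → lastLetter _ (par v)) (sym prefix) ⟩
    lastLetter _ (par (take k (snoc w ℓ)))         ∎
    where
    ℓ : ℕ
    ℓ = lastLetter (2 * suc (suc m) ∸ 1) (par w)
    lw : length w ≡ k
    lw = prefix-length w ℓ la
    prefix : take k (snoc w ℓ) ≡ w
    prefix = trans (take-snoc w ℓ k (subst (k ≤_) (sym lw) ≤-refl)) (take-all k w (subst (_≤ k) (sym lw) ≤-refl))
  ... | inj₁ k<sm = begin
    at (snoc w ℓ) (suc k)                          ≡⟨ at-snoc w ℓ (suc k) (subst (suc k ≤_) (sym lw) k<sm) ⟩
    at w (suc k)                                   ≡⟨ rule k c' k<sm differ' ⟩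
    lastLetter _ (par (take k w))                  ≡⟨ cong (λ v → lastLetter _ (par v)) (sym (take-snoc w ℓ k k≤w)) ⟩
    lastLetter _ (par (take k (snoc w ℓ)))         ∎
    where
    ℓ : ℕ
    ℓ = lastLetter (2 * suc (suc m) ∸ 1) (par w)
    lw : length w ≡ suc m
    lw = prefix-length w ℓ la
    k≤w : k ≤ length w
    k≤w = subst (k ≤_) (sym lw) k≤
    k≤w' : k ≤ length w'
    k≤w' = subst (k ≤_) (sym (prefix-length w' y lb)) k≤
    differ' : at w k ≢ at w' k
    differ' eq = differ (trans (at-snoc w ℓ k k≤w) (trans eq (sym (at-snoc w' y k k≤w'))))

letterRule : ∀ n → LetterRule n
letterRule zero          k ()
letterRule (suc zero)    k (there ())
letterRule (suc (suc m)) = letterRule-step m (letterRule (suc m))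

lastLetter-1 : ∀ {r} o → r ≢ 1 → lastLetter r o ≡ 1 → o ≡ false
lastLetter-1 true  r≢1 eq = ⊥-elim (r≢1 eq)
lastLetter-1 false _   _  = refl

lastLetter-r : ∀ {r} o → r ≢ 1 → lastLetter r o ≡ r → o ≡ true
lastLetter-r true  _   _  = refl
lastLetter-r false r≢1 eq = ⊥-elim (r≢1 (sym eq))

-- 2k+1 ≠ 1 for k ≥ 1, so the two hypotheses of the corollary identify the orientation.
odd≢1 : ∀ k → 2 * suc (suc k) ∸ 1 ≢ 1
odd≢1 k eq with m+n≡0⇒n≡0 k (suc-injective eq)
... | ()

-- Corollary 5.6.
corollary5p6 : (n : ℕ) → 2 ≤ n → (a b : List ℕ) → Follows (G n) a b
    → (k : ℕ) → 1 ≤ k → k < n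
    → at a k ≢ at b k
    → ((j : ℕ) → 1 ≤ j → j ≤ n → j ≢ k → at a j ≡ at b j)
    → (((j : ℕ) → k < j → j ≤ n → at a j ≡ 1)
        → (sum (take k a) + (k ∸ 1)) % 2 ≡ 0)
      × (((j : ℕ) → k < j → j ≤ n → at a j ≡ 2 * j ∸ 1)
        → (sum (take k a) + (k ∸ 1)) % 2 ≡ 1)
corollary5p6 (suc (suc m)) (s≤s (s≤s _)) a b (p , s , eq) (suc k') _ k<n differ _ =
  (λ ones → by-parity (lastLetter-1 (par (take k a)) (odd≢1 k') (trans (sym letter) (ones (suc k) ≤-refl k<n)))) ,
  (λ tops → by-parity (lastLetter-r (par (take k a)) (odd≢1 k') (trans (sym letter) (tops (suc k) ≤-refl k<n))))
  where
  k : ℕ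
  k = suc k'
  c : Consecutive (G (suc (suc m))) a b
  c = follows⇒consecutive p eq
  letter : at a (suc k) ≡ lastLetter (2 * suc k ∸ 1) (par (take k a))
  letter = letterRule (suc (suc m)) k c k<n differ
  -- par (a_1…a_k) is the parity of a_1+⋯+a_k+k
  length-prefix : length (take k a) ≡ k
  length-prefix = trans (length-take k a)
    (m≤n⇒m⊓n≡m (subst (k ≤_) (sym (proj₁ (consecutive-All c (length-G (suc (suc m)))))) (<⇒≤ k<n)))
  S : ℕ
  S = sum (take k a)
  by-parity : ∀ {v} → par (take k a) ≡ v → (S + k') % 2 ≡ (if v then 1 else 0)
  by-parity {v} par≡v = begin
    (S + k') % 2                                    ≡⟨ %2-by-successor (S + k') ⟩
    (if isEven (suc (S + k')) then 1 else 0)        ≡⟨ cong (λ i → if isEven i then 1 else 0) (sym (+-suc S k')) ⟩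
    (if isEven (S + k) then 1 else 0)               ≡⟨ cong (λ i → if isEven (S + i) then 1 else 0) (sym length-prefix) ⟩
    (if par (take k a) then 1 else 0)               ≡⟨ cong (if_then 1 else 0) par≡v ⟩
    (if v then 1 else 0)                            ∎
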